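{- Let $d$ be a degree sequence and let $\mathcal{S}=\{R_1,\dots,R_n\}$ be a set of distinct labeled realizations of $d$ on a common vertex set $V$. If a dial exists with respect to $\mathcal{S}$, then $R_1,\dots,R_n$ form a clique in the realization graph $\mathcal{G}(d)$. Furthermore, if some realization $R$ of a degree sequence $d$ contains the configuration $\mathcal{D}_n$, then $R$ belongs to a clique of size $n$ in $\mathcal{G}(d)$.
   Context: All graphs are finite and simple. A labeled realization of a degree sequence $d=(d_1,\dots,d_n)$ is a graph on the fixed vertex set $\{v_1,\dots,v_n\}$ in which $v_i$ has degree $d_i$. An alternating 4-cycle $[u,v:w,x]$ in a graph $H$ consists of four distinct vertices $u,v,w,x$ with $uv,wx\in E(H)$ and $ux,vw\notin E(H)$ (nothing is required of the pairs $\{u,w\},\{v,x\}$). A 2-switch on it deletes $uv,wx$ and adds $ux,vw$; this preserves all vertex degrees. The realization graph $\mathcal{G}(d)$ has the labeled realizations of $d$ as vertices, two being adjacent when one is obtained from the other by a single 2-switch. Dial: given a set $\mathcal{S}=\{R_1,\dots,R_n\}$ of labeled realizations of the same degree sequence on a common vertex set $V$, a dial with respect to $\mathcal{S}$ is a pair $(W,P)$ such that: (a) $P$ is the set of all pairs $\{a,b\}\subseteq V$ that are an edge in some $R_i$ and a non-edge in some $R_j$, and $W$ is the union of the pairs in $P$; (b) there are two vertices $u,v\in W$ such that $P$ consists exactly of the pairs $\{u,w\}$ and $\{v,w\}$ for $w\in W\setminus\{u,v\}$; (c) in every $R_i$, $u$ is adjacent to exactly one vertex $w_i$ of $W\setminus\{u,v\}$,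 and $v$ is non-adjacent to $w_i$ but adjacent to every vertex of $W\setminus\{u,v,w_i\}$. A configuration is a triple $(W,F,F')$ where $W$ is a set and $F,F'$ are disjoint sets of 2-element subsets of $W$; a graph $H$ contains it if there is an injective map $f:W\to V(H)$ sending each pair of $F$ to an edge of $H$ and each pair of $F'$ to a non-edge of $H$ (no condition on other pairs). $\mathcal{D}_n$ is the configuration with $n+2$ vertices $u,v,w_1,\dots,w_n$, edges $F=\{uw_1\}\cup\{vw_i: 2\le i\le n\}$ and non-edges $F'=\{vw_1\}\cup\{uw_i:2\le i\le n\}$. -}

module Defs where

open import Data.Nat using (ℕ; zero; suc; _+_)
open import Data.Bool using (Bool; true; false; if_then_else_; _∨_; _∧_)
open import Data.Fin using (Fin; zero; suc; _≟_)
open import Data.List using (List; map; allFin)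
open import Data.Nat.ListAction using (sum)
open import Data.Product using (Σ; ∃; ∃-syntax; _×_; _,_)
open import Data.Sum using (_⊎_)
open import Relation.Nullary using (¬_; does)
open import Relation.Binary.PropositionalEquality using (_≡_; _≢_)
open import Function.Bundles using (_⇔_)

record Graph (m : ℕ) : Set where
  field
    adj   : Fin m → Fin m → Bool
    sym   : ∀ a b → adj a b ≡ adj b a
    irrfl : ∀ a → adj a a ≡ false
open Graph public

_≈G_ : ∀ {m} → Graph m → Graph m → Set
G ≈G H = ∀ a b → adj G a b ≡ adj H a b

degree : ∀ {m} → Graph m → Fin m → ℕ
degree {m} G a = sum (map (λ b → if adj G a b then 1 else 0) (allFin m))

Realizes : ∀ {m} → (Fin m → ℕ) → Graph m → Set
Realizes d G = ∀ a → degree G a ≡ d a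

samePair : ∀ {m} → Fin m → Fin m → Fin m → Fin m → Bool
samePair a b x y =
  (does (a ≟ x) ∧ does (b ≟ y)) ∨ (does (a ≟ y) ∧ does (b ≟ x))

SamePair : ∀ {m} → Fin m → Fin m → Fin m → Fin m → Set
SamePair a b x y = (a ≡ x × b ≡ y) ⊎ (a ≡ y × b ≡ x)

record TwoSwitch {m} (H H' : Graph m) (u v w x : Fin m) : Set where
  field
    u≢v : u ≢ v
    u≢w : u ≢ w
    u≢x : u ≢ x
    v≢w : v ≢ w
    v≢x : v ≢ x
    w≢x : w ≢ x
    uv∈ : adj H u v ≡ true
    wx∈ : adj H w x ≡ true
    ux∉ : adj H u x ≡ false
    vw∉ : adj H v w ≡ false
    result : ∀ a b → adj H' a b ≡
      (if samePair a b u v ∨ samePair a b w x then false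
       else if samePair a b u x ∨ samePair a b v w then true
       else adj H a b)

RGAdj : ∀ {m} → Graph m → Graph m → Set
RGAdj H H' =
  (∃[ u ] ∃[ v ] ∃[ w ] ∃[ x ] TwoSwitch H H' u v w x)
  ⊎ (∃[ u ] ∃[ v ] ∃[ w ] ∃[ x ] TwoSwitch H' H u v w x)

Varying : ∀ {m n} → (Fin n → Graph m) → Fin m → Fin m → Set
Varying R a b = (∃[ i ] adj (R i) a b ≡ true) × (∃[ j ] adj (R j) a b ≡ false)

record Dial {m n} (R : Fin n → Graph m) : Set₁ where
  field
    W : Fin m → Set
    P : Fin m → Fin m → Set
    P-def : ∀ a b → P a b ⇔ Varying R a b
    W-def : ∀ a → W a ⇔ (∃[ b ] P a b)
    u v : Fin m
    u≢v : u ≢ v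
    u∈W : W u
    v∈W : W v
    P-shape : ∀ a b → P a b ⇔
      (∃[ w ] (W w × w ≢ u × w ≢ v × (SamePair a b u w ⊎ SamePair a b v w)))
    centre : ∀ i → ∃[ wᵢ ]
      ( W wᵢ × wᵢ ≢ u × wᵢ ≢ v
      × adj (R i) u wᵢ ≡ true
      × (∀ w → W w → w ≢ u → w ≢ v → adj (R i) u w ≡ true → w ≡ wᵢ)
      × adj (R i) v wᵢ ≡ false
      × (∀ w → W w → w ≢ u → w ≢ v → w ≢ wᵢ → adj (R i) v w ≡ true))

-- R contains the configuration D_n (here n = suc k, so w_1 is wₓ zero).
ContainsD : ∀ {m} → Graph m → ℕ → Set
ContainsD {m} R k =
  ∃[ u ] ∃[ v ] Σ (Fin (suc k) → Fin m) λ w →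
    u ≢ v
    × (∀ i → w i ≢ u) × (∀ i → w i ≢ v)
    × (∀ i j → w i ≡ w j → i ≡ j)
    × adj R u (w zero) ≡ true
    × adj R v (w zero) ≡ false
    × (∀ i → adj R v (w (suc i)) ≡ true)
    × (∀ i → adj R u (w (suc i)) ≡ false)

{-# OPTIONS --safe #-}
-- In every member R_i of a dial the hub u is joined to exactly one spoke end w_i and the hub v to
-- all the others, while off these spokes the members coincide; hence R_j is R_i switched on the
-- alternating cycle [u, w_i : v, w_j]. A copy of D_n in R gives such a family by switching the
-- spoke at u from w_1 to each w_i in turn, and these switches keep the degree sequence because a
-- 2-switch acts on every neighbourhood by a transposition of vertices.
module Submission where

open import Defs hiding (sym)
open import Data.Nat using (ℕ; zero; suc; _+_)
open import Data.Nat.Properties using (+-0-commutativeMonoid)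
open import Data.Bool using (Bool; true; false; if_then_else_; _∨_)
import Data.Bool.Properties as Bool
open import Data.Fin using (Fin; zero; suc; _≟_)
import Data.Fin.Permutation as Perm
import Data.Fin.Permutation.Components as PC
open import Data.List using (tabulate)
open import Data.List.Properties using (map-tabulate)
import Data.Nat.ListAction as List
open import Algebra.Properties.CommutativeMonoid.Sum +-0-commutativeMonoid
  using (sum; ∑-permute; sum-cong-≋)
open import Data.Product using (Σ; ∃-syntax; _×_; _,_; proj₁; proj₂)
open import Data.Sum using (_⊎_; inj₁; inj₂; [_,_]; swap)
open import Function using (_∘_; id)
open import Function.Bundles using (Equivalence)
open import Relation.Nullary using (¬_; Dec; yes; no; proof; contradiction)
open import Relation.Nullary.Decidable using (_×-dec_; _⊎-dec_; dec-true; dec-false)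
open import Relation.Nullary.Reflects using (Reflects; invert)
open import Relation.Binary.PropositionalEquality
  using (_≡_; _≢_; refl; sym; trans; cong; subst; ≢-sym; module ≡-Reasoning)

module _ {m : ℕ} where

  SamePair? : (a b x y : Fin m) → Dec (SamePair a b x y)
  SamePair? a b x y = (a ≟ x ×-dec b ≟ y) ⊎-dec (a ≟ y ×-dec b ≟ x)

  -- samePair a b x y is definitionally the Boolean of SamePair? a b x y.
  SamePair⇒samePair≡true : ∀ {a b x y : Fin m} → SamePair a b x y → samePair a b x y ≡ true
  SamePair⇒samePair≡true {a} {b} {x} {y} = dec-true (SamePair? a b x y)

  ¬SamePair⇒samePair≡false : ∀ {a b x y : Fin m} → ¬ SamePair a b x y → samePair a b x y ≡ false
  ¬SamePair⇒samePair≡false {a} {b} {x} {y} = dec-false (SamePair? a b x y)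

  samePair≡true⇒SamePair : ∀ {a b x y : Fin m} → samePair a b x y ≡ true → SamePair a b x y
  samePair≡true⇒SamePair {a} {b} {x} {y} e = invert (subst (Reflects _) e (proof (SamePair? a b x y)))

  samePair≡false⇒¬SamePair : ∀ {a b x y : Fin m} → samePair a b x y ≡ false → ¬ SamePair a b x y
  samePair≡false⇒¬SamePair e p = contradiction (trans (sym (SamePair⇒samePair≡true p)) e) λ ()

  SamePair-swap : ∀ {a b x y : Fin m} → SamePair a b x y → SamePair a b y x
  SamePair-swap = swap

  SamePair-flip : ∀ {a b x y : Fin m} → SamePair a b x y → SamePair b a x y
  SamePair-flip (inj₁ (a≡x , b≡y)) = inj₂ (b≡y , a≡x)
  SamePair-flip (inj₂ (a≡y , b≡x)) = inj₁ (b≡x , a≡y)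

  SamePair-diagonal : ∀ {a x y : Fin m} → SamePair a a x y → x ≡ y
  SamePair-diagonal (inj₁ (refl , refl)) = refl
  SamePair-diagonal (inj₂ (refl , refl)) = refl

  ¬SamePair : ∀ {a b x y : Fin m} → a ≢ x ⊎ b ≢ y → a ≢ y ⊎ b ≢ x → ¬ SamePair a b x y
  ¬SamePair (inj₁ a≢x) _ (inj₁ (a≡x , _)) = a≢x a≡x
  ¬SamePair (inj₂ b≢y) _ (inj₁ (_ , b≡y)) = b≢y b≡y
  ¬SamePair _ (inj₁ a≢y) (inj₂ (a≡y , _)) = a≢y a≡y
  ¬SamePair _ (inj₂ b≢x) (inj₂ (_ , b≡x)) = b≢x b≡x

  samePair-flip : ∀ (a b x y : Fin m) → samePair a b x y ≡ samePair b a x y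
  samePair-flip a b x y with SamePair? a b x y
  ... | yes p = trans (SamePair⇒samePair≡true p) (sym (SamePair⇒samePair≡true (SamePair-flip p)))
  ... | no ¬p =
    trans (¬SamePair⇒samePair≡false ¬p) (sym (¬SamePair⇒samePair≡false (¬p ∘ SamePair-flip)))

  adj-SamePair : ∀ (G : Graph m) {a b x y} → SamePair a b x y → adj G a b ≡ adj G x y
  adj-SamePair G (inj₁ (refl , refl)) = refl
  adj-SamePair G (inj₂ (refl , refl)) = Graph.sym G _ _

  Spoke : (u v c a b : Fin m) → Set
  Spoke u v c a b = SamePair a b u c ⊎ SamePair a b v c

  Spoke? : (u v c a b : Fin m) → Dec (Spoke u v c a b)
  Spoke? u v c a b = SamePair? a b u c ⊎-dec SamePair? a b v c

  Spoke-agree : ∀ (G G′ : Graph m) {u v c a b} → Spoke u v c a b →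
    adj G u c ≡ adj G′ u c → adj G v c ≡ adj G′ v c → adj G a b ≡ adj G′ a b
  Spoke-agree G G′ (inj₁ s) same-u same-v = trans (adj-SamePair G s) (trans same-u (sym (adj-SamePair G′ s)))
  Spoke-agree G G′ (inj₂ s) same-u same-v = trans (adj-SamePair G s) (trans same-v (sym (adj-SamePair G′ s)))

  ¬Spoke-hub₁ : ∀ {u v c c′ : Fin m} → u ≢ v → c′ ≢ u → c ≢ c′ → ¬ Spoke u v c′ u c
  ¬Spoke-hub₁ u≢v c′≢u c≢c′ =
    [ ¬SamePair (inj₂ c≢c′) (inj₁ (≢-sym c′≢u))
    , ¬SamePair (inj₁ u≢v) (inj₁ (≢-sym c′≢u)) ]

  ¬Spoke-hub₂ : ∀ {u v c c′ : Fin m} → u ≢ v → c′ ≢ v → c ≢ c′ → ¬ Spoke u v c′ v c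
  ¬Spoke-hub₂ u≢v c′≢v c≢c′ =
    [ ¬SamePair (inj₁ (≢-sym u≢v)) (inj₁ (≢-sym c′≢v))
    , ¬SamePair (inj₂ c≢c′) (inj₁ (≢-sym c′≢v)) ]

  transpose-matchˡ : ∀ (i j : Fin m) → PC.transpose i j i ≡ j
  transpose-matchˡ i j rewrite dec-true (i ≟ i) refl = refl

  transpose-matchʳ : ∀ {i j : Fin m} → i ≢ j → PC.transpose i j j ≡ i
  transpose-matchʳ {i} {j} i≢j rewrite dec-false (j ≟ i) (≢-sym i≢j) | dec-true (j ≟ j) refl = refl

  transpose-other : ∀ {i j k : Fin m} → k ≢ i → k ≢ j → PC.transpose i j k ≡ k
  transpose-other {i} {j} {k} k≢i k≢j rewrite dec-false (k ≟ i) k≢i | dec-false (k ≟ j) k≢j = refl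

indicator : Bool → ℕ
indicator b = if b then 1 else 0

sum-tabulate : ∀ {m} (f : Fin m → ℕ) → List.sum (tabulate f) ≡ sum f
sum-tabulate {zero} f = refl
sum-tabulate {suc m} f = cong (f zero +_) (sum-tabulate (f ∘ suc))

degree-∑ : ∀ {m} (G : Graph m) a → degree G a ≡ sum (indicator ∘ adj G a)
degree-∑ G a =
  trans (cong List.sum (map-tabulate id (indicator ∘ adj G a))) (sum-tabulate (indicator ∘ adj G a))

degree-permute : ∀ {m} (G G′ : Graph m) a (π : Perm.Permutation′ m) →
  (∀ b → adj G′ a b ≡ adj G a (π Perm.⟨$⟩ʳ b)) → degree G′ a ≡ degree G a
degree-permute G G′ a π same = begin
  degree G′ a                                 ≡⟨ degree-∑ G′ a ⟩
  sum (indicator ∘ adj G′ a)                  ≡⟨ sum-cong-≋ (cong indicator ∘ same) ⟩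
  sum (indicator ∘ adj G a ∘ (π Perm.⟨$⟩ʳ_))  ≡⟨ ∑-permute (indicator ∘ adj G a) π ⟨
  sum (indicator ∘ adj G a)                   ≡⟨ degree-∑ G a ⟨
  degree G a                                  ∎
  where open ≡-Reasoning

record AlternatingCycle {m} (H : Graph m) (u v w x : Fin m) : Set where
  field
    u≢v : u ≢ v
    u≢w : u ≢ w
    u≢x : u ≢ x
    v≢w : v ≢ w
    v≢x : v ≢ x
    w≢x : w ≢ x
    uv∈ : adj H u v ≡ true
    wx∈ : adj H w x ≡ true
    ux∉ : adj H u x ≡ false
    vw∉ : adj H v w ≡ false

module _ {m} {H : Graph m} {u v w x : Fin m} where

  switch : AlternatingCycle H u v w x → Graph m
  switch c = record { adj = switched ; sym = switched-sym ; irrfl = switched-irrfl }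
    where
    open AlternatingCycle c

    switched : Fin m → Fin m → Bool
    switched a b =
      if samePair a b u v ∨ samePair a b w x then false
      else if samePair a b u x ∨ samePair a b v w then true
      else adj H a b

    switched-sym : ∀ a b → switched a b ≡ switched b a
    switched-sym a b
      rewrite samePair-flip a b u v | samePair-flip a b w x
            | samePair-flip a b u x | samePair-flip a b v w | Graph.sym H a b = refl

    switched-irrfl : ∀ a → switched a a ≡ false
    switched-irrfl a
      rewrite ¬SamePair⇒samePair≡false (u≢v ∘ SamePair-diagonal {a = a})
            | ¬SamePair⇒samePair≡false (w≢x ∘ SamePair-diagonal {a = a})
            | ¬SamePair⇒samePair≡false (u≢x ∘ SamePair-diagonal {a = a})
            | ¬SamePair⇒samePair≡false (v≢w ∘ SamePair-diagonal {a = a}) = irrfl H a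

  switch-TwoSwitch : (c : AlternatingCycle H u v w x) → TwoSwitch H (switch c) u v w x
  switch-TwoSwitch c = record
    { u≢v = u≢v ; u≢w = u≢w ; u≢x = u≢x ; v≢w = v≢w ; v≢x = v≢x ; w≢x = w≢x
    ; uv∈ = uv∈ ; wx∈ = wx∈ ; ux∉ = ux∉ ; vw∉ = vw∉
    ; result = λ _ _ → refl }
    where open AlternatingCycle c

-- TwoSwitch stated pair by pair, a form visibly invariant under the symmetries of the 4-cycle.
record Flip {m} (H H′ : Graph m) (u v w x : Fin m) : Set where
  field
    cycle : AlternatingCycle H u v w x
    uv∉′ : adj H′ u v ≡ false
    wx∉′ : adj H′ w x ≡ false
    ux∈′ : adj H′ u x ≡ true
    vw∈′ : adj H′ v w ≡ true
    unchanged : ∀ a b → ¬ SamePair a b u v → ¬ SamePair a b w x →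
                ¬ SamePair a b u x → ¬ SamePair a b v w → adj H′ a b ≡ adj H a b
  open AlternatingCycle cycle public

module _ {m} {H H′ : Graph m} {u v w x : Fin m} where

  Flip⇒TwoSwitch : Flip H H′ u v w x → TwoSwitch H H′ u v w x
  Flip⇒TwoSwitch f = record
    { u≢v = u≢v ; u≢w = u≢w ; u≢x = u≢x ; v≢w = v≢w ; v≢x = v≢x ; w≢x = w≢x
    ; uv∈ = uv∈ ; wx∈ = wx∈ ; ux∉ = ux∉ ; vw∉ = vw∉
    ; result = result }
    where
    open Flip f
    result : ∀ a b → adj H′ a b ≡
      (if samePair a b u v ∨ samePair a b w x then false
       else if samePair a b u x ∨ samePair a b v w then true
       else adj H a b)
    result a b with samePair a b u v in e₁ | samePair a b w x in e₂
                  | samePair a b u x in e₃ | samePair a b v w in e₄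
    ... | true  | _     | _     | _     = trans (adj-SamePair H′ (samePair≡true⇒SamePair e₁)) uv∉′
    ... | false | true  | _     | _     = trans (adj-SamePair H′ (samePair≡true⇒SamePair e₂)) wx∉′
    ... | false | false | true  | _     = trans (adj-SamePair H′ (samePair≡true⇒SamePair e₃)) ux∈′
    ... | false | false | false | true  = trans (adj-SamePair H′ (samePair≡true⇒SamePair e₄)) vw∈′
    ... | false | false | false | false =
      unchanged a b (samePair≡false⇒¬SamePair e₁) (samePair≡false⇒¬SamePair e₂)
                    (samePair≡false⇒¬SamePair e₃) (samePair≡false⇒¬SamePair e₄)

  TwoSwitch⇒Flip : TwoSwitch H H′ u v w x → Flip H H′ u v w x
  TwoSwitch⇒Flip t = record
    { cycle = record
      { u≢v = u≢v ; u≢w = u≢w ; u≢x = u≢x ; v≢w = v≢w ; v≢x = v≢x ; w≢x = w≢x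
      ; uv∈ = uv∈ ; wx∈ = wx∈ ; ux∉ = ux∉ ; vw∉ = vw∉ }
    ; uv∉′ = uv∉′ ; wx∉′ = wx∉′ ; ux∈′ = ux∈′ ; vw∈′ = vw∈′
    ; unchanged = unchanged }
    where
    open TwoSwitch t
    is : ∀ {a b p q} → SamePair a b p q → samePair a b p q ≡ true
    is = SamePair⇒samePair≡true
    isn’t : ∀ {a b p q} → a ≢ p ⊎ b ≢ q → a ≢ q ⊎ b ≢ p → samePair a b p q ≡ false
    isn’t h₁ h₂ = ¬SamePair⇒samePair≡false (¬SamePair h₁ h₂)

    uv∉′ : adj H′ u v ≡ false
    uv∉′ rewrite result u v | is {u} {v} (inj₁ (refl , refl)) = refl
    wx∉′ : adj H′ w x ≡ false
    wx∉′ rewrite result w x | is {w} {x} (inj₁ (refl , refl)) | Bool.∨-zeroʳ (samePair w x u v) = refl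
    ux∈′ : adj H′ u x ≡ true
    ux∈′ rewrite result u x | isn’t {u} {x} {u} {v} (inj₂ (≢-sym v≢x)) (inj₁ u≢v)
               | isn’t {u} {x} {w} {x} (inj₁ u≢w) (inj₁ u≢x) | is {u} {x} (inj₁ (refl , refl)) = refl
    vw∈′ : adj H′ v w ≡ true
    vw∈′ rewrite result v w | isn’t {v} {w} {u} {v} (inj₁ (≢-sym u≢v)) (inj₂ (≢-sym u≢w))
               | isn’t {v} {w} {w} {x} (inj₁ v≢w) (inj₁ v≢x)
               | isn’t {v} {w} {u} {x} (inj₁ (≢-sym u≢v)) (inj₁ v≢x)
               | is {v} {w} (inj₁ (refl , refl)) = refl
    unchanged : ∀ a b → ¬ SamePair a b u v → ¬ SamePair a b w x →
                ¬ SamePair a b u x → ¬ SamePair a b v w → adj H′ a b ≡ adj H a b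
    unchanged a b n₁ n₂ n₃ n₄
      rewrite result a b | ¬SamePair⇒samePair≡false n₁ | ¬SamePair⇒samePair≡false n₂
            | ¬SamePair⇒samePair≡false n₃ | ¬SamePair⇒samePair≡false n₄ = refl

module _ {m} {H H′ : Graph m} where

  Flip-rotate : ∀ {u v w x} → Flip H H′ u v w x → Flip H H′ w x u v
  Flip-rotate {u} {v} {w} {x} f = record
    { cycle = record
      { u≢v = w≢x ; u≢w = ≢-sym u≢w ; u≢x = ≢-sym v≢w
      ; v≢w = ≢-sym u≢x ; v≢x = ≢-sym v≢x ; w≢x = u≢v
      ; uv∈ = wx∈ ; wx∈ = uv∈
      ; ux∉ = trans (Graph.sym H w v) vw∉ ; vw∉ = trans (Graph.sym H x u) ux∉ }
    ; uv∉′ = wx∉′ ; wx∉′ = uv∉′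
    ; ux∈′ = trans (Graph.sym H′ w v) vw∈′ ; vw∈′ = trans (Graph.sym H′ x u) ux∈′
    ; unchanged = λ a b n₁ n₂ n₃ n₄ →
        unchanged a b n₂ n₁ (n₄ ∘ SamePair-swap) (n₃ ∘ SamePair-swap) }
    where open Flip f

  Flip-reflect : ∀ {u v w x} → Flip H H′ u v w x → Flip H H′ v u x w
  Flip-reflect {u} {v} {w} {x} f = record
    { cycle = record
      { u≢v = ≢-sym u≢v ; u≢w = v≢x ; u≢x = v≢w ; v≢w = u≢x ; v≢x = u≢w ; w≢x = ≢-sym w≢x
      ; uv∈ = trans (Graph.sym H v u) uv∈ ; wx∈ = trans (Graph.sym H x w) wx∈
      ; ux∉ = vw∉ ; vw∉ = ux∉ }
    ; uv∉′ = trans (Graph.sym H′ v u) uv∉′ ; wx∉′ = trans (Graph.sym H′ x w) wx∉′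
    ; ux∈′ = vw∈′ ; vw∈′ = ux∈′
    ; unchanged = λ a b n₁ n₂ n₃ n₄ →
        unchanged a b (n₁ ∘ SamePair-swap) (n₂ ∘ SamePair-swap) n₄ n₃ }
    where open Flip f

  Flip-neighbourhood : ∀ {u v w x} → Flip H H′ u v w x → ∀ b → adj H′ u b ≡ adj H u (PC.transpose v x b)
  Flip-neighbourhood {u} {v} {w} {x} f b = by-cases (b ≟ v) (b ≟ x)
    where
    open Flip f
    by-cases : Dec (b ≡ v) → Dec (b ≡ x) → adj H′ u b ≡ adj H u (PC.transpose v x b)
    by-cases (yes refl) _ =
      trans uv∉′ (trans (sym ux∉) (cong (adj H u) (sym (transpose-matchˡ v x))))
    by-cases (no _) (yes refl) =
      trans ux∈′ (trans (sym uv∈) (cong (adj H u) (sym (transpose-matchʳ v≢x))))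
    by-cases (no b≢v) (no b≢x) =
      trans (unchanged u b (¬SamePair (inj₂ b≢v) (inj₁ u≢v)) (¬SamePair (inj₁ u≢w) (inj₁ u≢x))
                           (¬SamePair (inj₂ b≢x) (inj₁ u≢x)) (¬SamePair (inj₁ u≢v) (inj₁ u≢w)))
            (cong (adj H u) (sym (transpose-other b≢v b≢x)))

  Flip-degree : ∀ {u v w x} → Flip H H′ u v w x → ∀ a → degree H′ a ≡ degree H a
  Flip-degree {u} {v} {w} {x} f a with a ≟ u
  ... | yes refl = degree-permute H H′ a (Perm.transpose v x) (Flip-neighbourhood f)
  ... | no a≢u with a ≟ v
  ... | yes refl = degree-permute H H′ a (Perm.transpose u w) (Flip-neighbourhood (Flip-reflect f))
  ... | no a≢v with a ≟ w
  ... | yes refl = degree-permute H H′ a (Perm.transpose x v) (Flip-neighbourhood (Flip-rotate f))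
  ... | no a≢w with a ≟ x
  ... | yes refl = degree-permute H H′ a (Perm.transpose w u)
                     (Flip-neighbourhood (Flip-reflect (Flip-rotate f)))
  ... | no a≢x = degree-permute H H′ a Perm.id λ b →
    Flip.unchanged f a b (¬SamePair (inj₁ a≢u) (inj₁ a≢v)) (¬SamePair (inj₁ a≢w) (inj₁ a≢x))
                         (¬SamePair (inj₁ a≢u) (inj₁ a≢x)) (¬SamePair (inj₁ a≢v) (inj₁ a≢w))

TwoSwitch-realizes : ∀ {m} {d : Fin m → ℕ} {H H′ : Graph m} {u v w x} →
  TwoSwitch H H′ u v w x → Realizes d H → Realizes d H′
TwoSwitch-realizes t r a = trans (Flip-degree (TwoSwitch⇒Flip t) a) (r a)

-- The shape shared by a dial and by the realizations built from a copy of D_n.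
record SpokeFamily {m n} (G : Fin n → Graph m) (u v : Fin m) (c : Fin n → Fin m) : Set where
  field
    u≢v : u ≢ v
    c≢u : ∀ i → c i ≢ u
    c≢v : ∀ i → c i ≢ v
    c-distinct : ∀ {i j} → i ≢ j → c i ≢ c j
    u-own : ∀ i → adj (G i) u (c i) ≡ true
    u-other : ∀ {i j} → i ≢ j → adj (G i) u (c j) ≡ false
    v-own : ∀ i → adj (G i) v (c i) ≡ false
    v-other : ∀ {i j} → i ≢ j → adj (G i) v (c j) ≡ true
    agree-off-spokes : ∀ i j a b → ¬ Spoke u v (c i) a b → ¬ Spoke u v (c j) a b →
                       adj (G i) a b ≡ adj (G j) a b

  flip : ∀ {i j} → i ≢ j → Flip (G i) (G j) u (c i) v (c j)
  flip {i} {j} i≢j = record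
    { cycle = record
      { u≢v = ≢-sym (c≢u i) ; u≢w = u≢v ; u≢x = ≢-sym (c≢u j)
      ; v≢w = c≢v i ; v≢x = c-distinct i≢j ; w≢x = ≢-sym (c≢v j)
      ; uv∈ = u-own i ; wx∈ = v-other i≢j ; ux∉ = u-other i≢j
      ; vw∉ = trans (Graph.sym (G i) (c i) v) (v-own i) }
    ; uv∉′ = u-other (≢-sym i≢j) ; wx∉′ = v-own j ; ux∈′ = u-own j
    ; vw∈′ = trans (Graph.sym (G j) (c i) v) (v-other (≢-sym i≢j))
    ; unchanged = λ a b ¬uci ¬vcj ¬ucj ¬civ →
        agree-off-spokes j i a b [ ¬ucj , ¬vcj ] [ ¬uci , ¬civ ∘ SamePair-swap ] }

  distinct : ∀ {i j} → i ≢ j → ¬ (G i ≈G G j)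
  distinct {i} {j} i≢j G≈ =
    contradiction (trans (sym (u-own i)) (trans (G≈ u (c i)) (u-other (≢-sym i≢j)))) λ ()

  adjacent : ∀ {i j} → i ≢ j → RGAdj (G i) (G j)
  adjacent {i} {j} i≢j = inj₁ (u , c i , v , c j , Flip⇒TwoSwitch (flip i≢j))

module DialSpokes {m n} {R : Fin n → Graph m} (D : Dial R) where
  open Dial D

  spoke : Fin n → Fin m
  spoke i = proj₁ (centre i)

  spoke∈W : ∀ i → W (spoke i)
  spoke∈W i = proj₁ (proj₂ (centre i))

  spoke≢u : ∀ i → spoke i ≢ u
  spoke≢u i = proj₁ (proj₂ (proj₂ (centre i)))

  spoke≢v : ∀ i → spoke i ≢ v
  spoke≢v i = proj₁ (proj₂ (proj₂ (proj₂ (centre i))))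

  u-spoke : ∀ i → adj (R i) u (spoke i) ≡ true
  u-spoke i = proj₁ (proj₂ (proj₂ (proj₂ (proj₂ (centre i)))))

  u-spoke-unique : ∀ i w → W w → w ≢ u → w ≢ v → adj (R i) u w ≡ true → w ≡ spoke i
  u-spoke-unique i = proj₁ (proj₂ (proj₂ (proj₂ (proj₂ (proj₂ (centre i))))))

  v-spoke : ∀ i → adj (R i) v (spoke i) ≡ false
  v-spoke i = proj₁ (proj₂ (proj₂ (proj₂ (proj₂ (proj₂ (proj₂ (centre i)))))))

  v-off-spoke : ∀ i w → W w → w ≢ u → w ≢ v → w ≢ spoke i → adj (R i) v w ≡ true
  v-off-spoke i = proj₂ (proj₂ (proj₂ (proj₂ (proj₂ (proj₂ (proj₂ (centre i)))))))

  u-off-spoke : ∀ i w → W w → w ≢ u → w ≢ v → w ≢ spoke i → adj (R i) u w ≡ false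
  u-off-spoke i w w∈W w≢u w≢v w≢spoke with adj (R i) u w in e
  ... | true = contradiction (u-spoke-unique i w w∈W w≢u w≢v e) w≢spoke
  ... | false = refl

  varying : ∀ {i j a b} → adj (R i) a b ≢ adj (R j) a b → Varying R a b
  varying {i} {j} {a} {b} ne with adj (R i) a b in eᵢ | adj (R j) a b in eⱼ
  ... | true  | true  = contradiction refl ne
  ... | true  | false = (i , eᵢ) , (j , eⱼ)
  ... | false | true  = (j , eⱼ) , (i , eᵢ)
  ... | false | false = contradiction refl ne

  varying-on-spoke : ∀ {a b} → Varying R a b → ∃[ w ] (W w × w ≢ u × w ≢ v × Spoke u v w a b)
  varying-on-spoke {a} {b} = Equivalence.to (P-shape a b) ∘ Equivalence.from (P-def a b)

  -- A pair on which R i and R j differ is a spoke of some w ∈ W; unless w is spoke i or spoke j,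
  -- both graphs join w to v and not to u.
  agree-off-spokes : ∀ i j a b → ¬ Spoke u v (spoke i) a b → ¬ Spoke u v (spoke j) a b →
                     adj (R i) a b ≡ adj (R j) a b
  agree-off-spokes i j a b ¬sᵢ ¬sⱼ with adj (R i) a b Bool.≟ adj (R j) a b
  ... | yes same = same
  ... | no differ with varying-on-spoke (varying differ)
  ... | w , w∈W , w≢u , w≢v , s = contradiction
          (Spoke-agree (R i) (R j) s
            (trans (u-off-spoke i w w∈W w≢u w≢v w≢spokeᵢ) (sym (u-off-spoke j w w∈W w≢u w≢v w≢spokeⱼ)))
            (trans (v-off-spoke i w w∈W w≢u w≢v w≢spokeᵢ) (sym (v-off-spoke j w w∈W w≢u w≢v w≢spokeⱼ))))
          differ
    where
    w≢spokeᵢ : w ≢ spoke i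
    w≢spokeᵢ refl = ¬sᵢ s
    w≢spokeⱼ : w ≢ spoke j
    w≢spokeⱼ refl = ¬sⱼ s

  spoke-distinct : (∀ i j → i ≢ j → ¬ (R i ≈G R j)) → ∀ {i j} → i ≢ j → spoke i ≢ spoke j
  spoke-distinct distinct {i} {j} i≢j same-spoke = distinct i j i≢j R≈
    where
    R≈ : R i ≈G R j
    R≈ a b with Spoke? u v (spoke i) a b
    ... | yes s = Spoke-agree (R i) (R j) s
          (trans (u-spoke i) (sym (trans (cong (adj (R j) u) same-spoke) (u-spoke j))))
          (trans (v-spoke i) (sym (trans (cong (adj (R j) v) same-spoke) (v-spoke j))))
    ... | no ¬s = agree-off-spokes i j a b ¬s (subst (λ z → ¬ Spoke u v z a b) same-spoke ¬s)

  spokeFamily : (∀ i j → i ≢ j → ¬ (R i ≈G R j)) → SpokeFamily R u v spoke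
  spokeFamily distinct = record
    { u≢v = u≢v ; c≢u = spoke≢u ; c≢v = spoke≢v ; c-distinct = spoke-distinct distinct
    ; u-own = u-spoke ; v-own = v-spoke
    ; u-other = λ {i} {j} i≢j → u-off-spoke i (spoke j) (spoke∈W j) (spoke≢u j) (spoke≢v j)
                                  (spoke-distinct distinct (≢-sym i≢j))
    ; v-other = λ {i} {j} i≢j → v-off-spoke i (spoke j) (spoke∈W j) (spoke≢u j) (spoke≢v j)
                                  (spoke-distinct distinct (≢-sym i≢j))
    ; agree-off-spokes = agree-off-spokes }

-- Q (1 + t) is R switched on [u, w 0 : v, w (1 + t)]: the spoke at u moves from w 0 to w (1 + t).
module ConfigurationSwitches {m k} (R : Graph m) (u v : Fin m) (w : Fin (suc k) → Fin m)
  (u≢v : u ≢ v) (w≢u : ∀ i → w i ≢ u) (w≢v : ∀ i → w i ≢ v)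
  (w-injective : ∀ i j → w i ≡ w j → i ≡ j)
  (uw₀∈ : adj R u (w zero) ≡ true) (vw₀∉ : adj R v (w zero) ≡ false)
  (vw∈ : ∀ t → adj R v (w (suc t)) ≡ true) (uw∉ : ∀ t → adj R u (w (suc t)) ≡ false) where

  w-distinct : ∀ {i j} → i ≢ j → w i ≢ w j
  w-distinct i≢j = i≢j ∘ w-injective _ _

  cycle : ∀ t → AlternatingCycle R u (w zero) v (w (suc t))
  cycle t = record
    { u≢v = ≢-sym (w≢u zero) ; u≢w = u≢v ; u≢x = ≢-sym (w≢u (suc t))
    ; v≢w = w≢v zero ; v≢x = w-distinct λ () ; w≢x = ≢-sym (w≢v (suc t))
    ; uv∈ = uw₀∈ ; wx∈ = vw∈ t ; ux∉ = uw∉ t ; vw∉ = trans (Graph.sym R (w zero) v) vw₀∉ }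

  Q : Fin (suc k) → Graph m
  Q zero = R
  Q (suc t) = switch (cycle t)

  switches : ∀ t → TwoSwitch R (Q (suc t)) u (w zero) v (w (suc t))
  switches t = switch-TwoSwitch (cycle t)

  flips : ∀ t → Flip R (Q (suc t)) u (w zero) v (w (suc t))
  flips t = TwoSwitch⇒Flip (switches t)

  Q-realizes : ∀ {d} → Realizes d R → ∀ i → Realizes d (Q i)
  Q-realizes r zero = r
  Q-realizes r (suc t) = TwoSwitch-realizes (switches t) r

  Q-agrees-with-R : ∀ i a b → ¬ Spoke u v (w zero) a b → ¬ Spoke u v (w i) a b → adj (Q i) a b ≡ adj R a b
  Q-agrees-with-R zero a b _ _ = refl
  Q-agrees-with-R (suc t) a b ¬s₀ ¬sₜ =
    Flip.unchanged (flips t) a b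
      (¬s₀ ∘ inj₁) (¬sₜ ∘ inj₂) (¬sₜ ∘ inj₁) (¬s₀ ∘ inj₂ ∘ SamePair-swap)

  u-own : ∀ i → adj (Q i) u (w i) ≡ true
  u-own zero = uw₀∈
  u-own (suc t) = Flip.ux∈′ (flips t)

  v-own : ∀ i → adj (Q i) v (w i) ≡ false
  v-own zero = vw₀∉
  v-own (suc t) = Flip.wx∉′ (flips t)

  u-other : ∀ {i j} → i ≢ j → adj (Q i) u (w j) ≡ false
  u-other {zero} {zero} i≢j = contradiction refl i≢j
  u-other {zero} {suc t} _ = uw∉ t
  u-other {suc s} {zero} _ = Flip.uv∉′ (flips s)
  u-other {suc s} {suc t} s≢t =
    trans (Q-agrees-with-R (suc s) u (w (suc t))
            (¬Spoke-hub₁ u≢v (w≢u zero) (w-distinct λ ()))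
            (¬Spoke-hub₁ u≢v (w≢u (suc s)) (w-distinct (≢-sym s≢t))))
          (uw∉ t)

  v-other : ∀ {i j} → i ≢ j → adj (Q i) v (w j) ≡ true
  v-other {zero} {zero} i≢j = contradiction refl i≢j
  v-other {zero} {suc t} _ = vw∈ t
  v-other {suc s} {zero} _ = trans (Graph.sym (Q (suc s)) v (w zero)) (Flip.vw∈′ (flips s))
  v-other {suc s} {suc t} s≢t =
    trans (Q-agrees-with-R (suc s) v (w (suc t))
            (¬Spoke-hub₂ u≢v (w≢v zero) (w-distinct λ ()))
            (¬Spoke-hub₂ u≢v (w≢v (suc s)) (w-distinct (≢-sym s≢t))))
          (vw∈ t)

  -- Besides their own spokes, Q i and Q j differ from R only on the spokes of w 0, where both
  -- take the values of a member whose u-spoke lies elsewhere.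
  agree-off-spokes : ∀ i j a b → ¬ Spoke u v (w i) a b → ¬ Spoke u v (w j) a b →
                     adj (Q i) a b ≡ adj (Q j) a b
  agree-off-spokes i j a b ¬sᵢ ¬sⱼ with Spoke? u v (w zero) a b
  ... | no ¬s₀ = trans (Q-agrees-with-R i a b ¬s₀ ¬sᵢ) (sym (Q-agrees-with-R j a b ¬s₀ ¬sⱼ))
  ... | yes s₀ = Spoke-agree (Q i) (Q j) s₀
                   (trans (u-other i≢0) (sym (u-other j≢0)))
                   (trans (v-other i≢0) (sym (v-other j≢0)))
    where
    i≢0 : i ≢ zero
    i≢0 refl = ¬sᵢ s₀
    j≢0 : j ≢ zero
    j≢0 refl = ¬sⱼ s₀

  spokeFamily : SpokeFamily Q u v w
  spokeFamily = record
    { u≢v = u≢v ; c≢u = w≢u ; c≢v = w≢v ; c-distinct = w-distinct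
    ; u-own = u-own ; u-other = u-other ; v-own = v-own ; v-other = v-other
    ; agree-off-spokes = agree-off-spokes }

dial⇒clique : ∀ {m n} {R : Fin n → Graph m} → (∀ i j → i ≢ j → ¬ (R i ≈G R j)) → Dial R →
  ∀ i j → i ≢ j → RGAdj (R i) (R j)
dial⇒clique distinct D i j = SpokeFamily.adjacent (DialSpokes.spokeFamily D distinct)

configuration⇒clique : ∀ {m k} {d : Fin m → ℕ} {R : Graph m} → Realizes d R → ContainsD R k →
  Σ (Fin (suc k) → Graph m) λ Q →
    (∀ i → Realizes d (Q i))
    × (∀ i j → i ≢ j → ¬ (Q i ≈G Q j))
    × (∀ i j → i ≢ j → RGAdj (Q i) (Q j))
    × (∃[ i ] (Q i ≈G R))
configuration⇒clique {R = R} realizes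
  (u , v , w , u≢v , w≢u , w≢v , w-injective , uw₀∈ , vw₀∉ , vw∈ , uw∉) =
  Q , Q-realizes realizes , (λ i j → SpokeFamily.distinct spokeFamily) ,
  (λ i j → SpokeFamily.adjacent spokeFamily) , (zero , λ _ _ → refl)
  where open ConfigurationSwitches R u v w u≢v w≢u w≢v w-injective uw₀∈ vw₀∉ vw∈ uw∉

lemma2 : ((m n : ℕ) (d : Fin m → ℕ) (R : Fin n → Graph m)
            → (∀ i → Realizes d (R i))
            → (∀ i j → i ≢ j → ¬ (R i ≈G R j))
            → Dial R
            → ∀ i j → i ≢ j → RGAdj (R i) (R j))
       × ((m k : ℕ) (d : Fin m → ℕ) (R : Graph m)
            → Realizes d R
            → ContainsD R k
            → Σ (Fin (suc k) → Graph m) λ Q →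
                (∀ i → Realizes d (Q i))
                × (∀ i j → i ≢ j → ¬ (Q i ≈G Q j))
                × (∀ i j → i ≢ j → RGAdj (Q i) (Q j))
                × (∃[ i ] (Q i ≈G R)))
lemma2 = (λ m n d R _ distinct → dial⇒clique distinct) , (λ m k d R → configuration⇒clique {m} {k} {d} {R})
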